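{- Let $\alpha(k)$ be the largest odd divisor of $k$, $V(n)=\sum_{k=1}^n\frac{\alpha(k)}{k}$, $U(n)=\sum_{k=1}^n\alpha(k)$ and $G(n)=\sum_{k=1}^n\frac{n+1-k}{k}\alpha(k)=(n+1)V(n)-U(n)$. Then: (a) For every positive integer $n$, $G(2n)=n(n+1)+G(n)-\frac12V(n)$ and $G(2n+1)=(n+1)^2+G(n)$. (b) For every positive integer $n$, $\frac{n(n+7/4)}{3}\le G(n)\le\frac{n(n+2)}{3}$.
   Context: $\alpha(k)$ is the largest odd divisor of the positive integer $k$. -}

module Defs where

open import Data.Nat using (ℕ; zero; suc; _⊔_)
open import Data.Nat.Divisibility using (_∣_; _∣?_)
open import Data.List using (List; filter; upTo; foldr)
open import Data.Product using (_×_)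
open import Relation.Nullary using (¬_; ¬?)
open import Relation.Nullary.Decidable using (_×-dec_)
open import Data.Integer using (+_)
open import Data.Rational using (ℚ; _/_; _+_; 0ℚ)

Odd : ℕ → Set
Odd d = ¬ (2 ∣ d)

-- α k = largest odd divisor of k (the maximum of the odd divisors d of k
-- with 1 ≤ d ≤ k; for k ≥ 1 this list is nonempty since 1 is among them).
α : ℕ → ℕ
α k = foldr _⊔_ 0 (filter (λ d → (d ∣? k) ×-dec ¬? (2 ∣? d)) (upTo (suc k)))

toℚ : ℕ → ℚ
toℚ n = (+ n) / 1

sumℚ : ℕ → (ℕ → ℚ) → ℚ
sumℚ zero    f = 0ℚ
sumℚ (suc n) f = sumℚ n f + f n

V : ℕ → ℚ
V n = sumℚ n (λ i → (+ α (suc i)) / suc i)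

U : ℕ → ℕ
U zero    = 0
U (suc n) = U n Data.Nat.+ α (suc n)

-- G(n) = Σ_{k=1}^n (n+1-k)/k · α(k)   (k = suc i, so n+1-k = n ∸ i)
G : ℕ → ℚ
G n = sumℚ n (λ i → (+ ((n Data.Nat.∸ i) Data.Nat.* α (suc i))) / suc i)

-- Since α(2k+1) = 2k+1 and α(2k) = α(k), splitting the sums by parity gives
-- V(2n) = V(n)/2 + n, V(2n+1) = V(n)/2 + n + 1, U(2n) = U(n) + n² and
-- U(2n+1) = U(n) + (n+1)², and (a) follows from G = (n+1)V − U by algebra.
-- For (b), induct along n ↦ 2n, 2n+1: the recursions of (a) reduce each step
-- to a polynomial inequality in n once V is controlled, and V itself satisfies
-- 2n/3 ≤ V(n) ≤ (5n+1)/6 (and V(n) ≤ 5n/6 for n ≥ 2) by the same induction.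
module Submission where

open import Defs
open import Data.Nat using (ℕ; zero; suc; NonZero; s≤s; z≤n)
import Data.Nat as ℕ
import Data.Nat.Properties as ℕ
open import Data.Nat.Coprimality using (Coprime; coprime-divisor)
open import Data.Nat.Divisibility
  using (_∣_; _∣?_; ∣-refl; ∣-trans; ∣⇒≤; n∣m*n; m∣m*n; ∣m+n∣m⇒∣n; ∣1⇒≡1; _∣0)
open import Data.Nat.Induction using (<-rec)
open import Data.Nat.Primality using (prime⇒irreducible; prime[2])
open import Data.Nat.Tactic.RingSolver using (solve-∀)
open import Data.Integer using (+_)
import Data.Integer as ℤ
import Data.Integer.Properties as ℤ
open import Data.List using (List; []; _∷_; filter; upTo; foldr)
open import Data.List.Membership.Propositional using (_∈_)
open import Data.List.Membership.Propositional.Properties using (∈-upTo⁺; ∈-filter⁺; ∈-filter⁻)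
open import Data.List.Relation.Unary.Any using (here; there)
open import Data.Product using (_×_; _,_; proj₂)
open import Data.Rational using (ℚ; _/_; _+_; _-_; _*_; _≤_; 0ℚ; 1ℚ; NonNegative; toℚᵘ; fromℚᵘ)
open import Data.Rational.Properties
  using ( /-cong; fromℚᵘ-cong; fromℚᵘ-toℚᵘ; toℚᵘ-fromℚᵘ; toℚᵘ-homo-+; toℚᵘ-homo-*
        ; ≤ᵇ⇒≤; +-mono-≤; +-monoʳ-≤; +-monoˡ-≤; *-monoˡ-≤-nonNeg; neg-antimono-≤; +-identityʳ
        ; nonNegative⁻¹; normalize-nonNeg; nonNeg+nonNeg⇒nonNeg; nonNeg*nonNeg⇒nonNeg
        ; module ≤-Reasoning)
open import Data.Rational.Unnormalised using (mkℚᵘ; *≡*; _≃_)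
import Data.Rational.Unnormalised.Properties as ℚᵘ
open import Data.Rational.Solver using (module +-*-Solver)
open import Data.Sum using (inj₁; inj₂)
open import Function using (_∘_)
open import Relation.Binary.PropositionalEquality
  using (_≡_; refl; sym; trans; cong; cong₂; subst; module ≡-Reasoning)
open import Relation.Nullary using (Dec; ¬?; contradiction)
open import Relation.Nullary.Decidable using (_×-dec_)

open +-*-Solver

∈⇒≤foldr⊔ : ∀ {x} xs → x ∈ xs → x ℕ.≤ foldr ℕ._⊔_ 0 xs
∈⇒≤foldr⊔ (y ∷ ys) (here refl) = ℕ.m≤m⊔n y _
∈⇒≤foldr⊔ (y ∷ ys) (there x∈ys) = ℕ.≤-trans (∈⇒≤foldr⊔ ys x∈ys) (ℕ.m≤n⊔m y _)

foldr⊔-lub : ∀ {b} xs → (∀ {x} → x ∈ xs → x ℕ.≤ b) → foldr ℕ._⊔_ 0 xs ℕ.≤ b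
foldr⊔-lub []       _  = ℕ.z≤n
foldr⊔-lub (y ∷ ys) ≤b = ℕ.⊔-lub (≤b (here refl)) (foldr⊔-lub ys (≤b ∘ there))

odd⇒coprime-2 : ∀ {d} → Odd d → Coprime d 2
odd⇒coprime-2 2∤d (i∣d , i∣2) with prime⇒irreducible prime[2] i∣2
... | inj₁ i≡1 = i≡1
... | inj₂ refl = contradiction i∣d 2∤d

odd-1+2* : ∀ m → Odd (suc (2 ℕ.* m))
odd-1+2* m 2∣1+2m = contradiction (∣1⇒≡1 2∣1) λ ()
  where
  2∣1 : 2 ∣ 1
  2∣1 = ∣m+n∣m⇒∣n (subst (2 ∣_) (ℕ.+-comm 1 (2 ℕ.* m)) 2∣1+2m) (m∣m*n m)

oddDivisor? : ∀ k d → Dec (d ∣ k × Odd d)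
oddDivisor? k d = (d ∣? k) ×-dec ¬? (2 ∣? d)

oddDivisors : ℕ → List ℕ
oddDivisors k = filter (oddDivisor? k) (upTo (suc k))

∈-oddDivisors⁺ : ∀ {d k} → .{{NonZero k}} → d ∣ k → Odd d → d ∈ oddDivisors k
∈-oddDivisors⁺ d∣k 2∤d = ∈-filter⁺ (oddDivisor? _) (∈-upTo⁺ (ℕ.s≤s (∣⇒≤ d∣k))) (d∣k , 2∤d)

∈-oddDivisors⁻ : ∀ {d k} → d ∈ oddDivisors k → d ∣ k × Odd d
∈-oddDivisors⁻ {k = k} d∈ = proj₂ (∈-filter⁻ (oddDivisor? k) {xs = upTo (suc k)} d∈)

odd-divisor≤α : ∀ {d k} → .{{NonZero k}} → d ∣ k → Odd d → d ℕ.≤ α k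
odd-divisor≤α d∣k 2∤d = ∈⇒≤foldr⊔ _ (∈-oddDivisors⁺ d∣k 2∤d)

α-lub : ∀ k {b} → (∀ {d} → d ∣ k → Odd d → d ℕ.≤ b) → α k ℕ.≤ b
α-lub k ≤b = foldr⊔-lub (oddDivisors k) λ d∈ → let d∣k , 2∤d = ∈-oddDivisors⁻ d∈ in ≤b d∣k 2∤d

α-odd : ∀ {k} → Odd k → α k ≡ k
α-odd {zero}      2∤0 = contradiction (2 ∣0) 2∤0
α-odd {k@(suc _)} 2∤k = ℕ.≤-antisym (α-lub k λ d∣k _ → ∣⇒≤ d∣k) (odd-divisor≤α ∣-refl 2∤k)

α-2* : ∀ k → α (2 ℕ.* k) ≡ α k
α-2* zero      = refl
α-2* k@(suc _) = ℕ.≤-antisym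
  (α-lub (2 ℕ.* k) λ d∣2k 2∤d → odd-divisor≤α (coprime-divisor (odd⇒coprime-2 2∤d) d∣2k) 2∤d)
  (α-lub k λ d∣k 2∤d → odd-divisor≤α (∣-trans d∣k (n∣m*n 2)) 2∤d)

α-1+2* : ∀ m → α (suc (2 ℕ.* m)) ≡ suc (2 ℕ.* m)
α-1+2* m = α-odd (odd-1+2* m)

α-2+2* : ∀ m → α (suc (suc (2 ℕ.* m))) ≡ α (suc m)
α-2+2* m = trans (cong α (sym (ℕ.*-suc 2 m))) (α-2* (suc m))

data Halving : ℕ → Set where
  even : ∀ n → Halving (2 ℕ.* n)
  odd  : ∀ n → Halving (suc (2 ℕ.* n))

halving : ∀ n → Halving n
halving zero = even 0
halving (suc n) with halving n
... | even m = odd m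
... | odd m  = subst Halving (ℕ.*-suc 2 m) (even (suc m))

binary-induction : {P : ℕ → Set} → P 0 →
                   (∀ n → P n → P (suc (2 ℕ.* n))) →
                   (∀ n → P (suc n) → P (2 ℕ.* suc n)) →
                   ∀ n → P n
binary-induction {P} P0 P-odd P-even = <-rec P step
  where
  step : ∀ n → (∀ {m} → m ℕ.< n → P m) → P n
  step n rec with halving n
  ... | even zero    = P0
  ... | even (suc m) = P-even m (rec (ℕ.m<m+n (suc m) ℕ.z<s))
  ... | odd m        = P-odd m (rec (ℕ.s≤s (ℕ.m≤m+n m _)))

/-cross : ∀ {a b} c d → a ℕ.* suc d ≡ b ℕ.* suc c → + a / suc c ≡ + b / suc d
/-cross {a} {b} c d eq = fromℚᵘ-cong {mkℚᵘ (+ a) c} {mkℚᵘ (+ b) d}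
  (*≡* (trans (sym (ℤ.pos-* a (suc d))) (trans (cong +_ eq) (ℤ.pos-* b (suc c)))))

≡fromℚᵘ : ∀ {p q} → toℚᵘ p ≃ q → p ≡ fromℚᵘ q
≡fromℚᵘ {p} p≃q = trans (sym (fromℚᵘ-toℚᵘ p)) (fromℚᵘ-cong p≃q)

/-*-/ : ∀ a b c d → (+ a / suc c) * (+ b / suc d) ≡ + (a ℕ.* b) / (suc c ℕ.* suc d)
/-*-/ a b c d = ≡fromℚᵘ (ℚᵘ.≃-trans (toℚᵘ-homo-* (+ a / suc c) (+ b / suc d))
  (ℚᵘ.≃-trans (ℚᵘ.*-cong (toℚᵘ-fromℚᵘ (mkℚᵘ (+ a) c)) (toℚᵘ-fromℚᵘ (mkℚᵘ (+ b) d)))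
              (ℚᵘ.≃-reflexive (cong (λ i → mkℚᵘ i (d ℕ.+ c ℕ.* suc d)) (sym (ℤ.pos-* a b))))))

/-+-/ : ∀ a b c d →
        (+ a / suc c) + (+ b / suc d) ≡ + (a ℕ.* suc d ℕ.+ b ℕ.* suc c) / (suc c ℕ.* suc d)
/-+-/ a b c d = ≡fromℚᵘ (ℚᵘ.≃-trans (toℚᵘ-homo-+ (+ a / suc c) (+ b / suc d))
  (ℚᵘ.≃-trans (ℚᵘ.+-cong (toℚᵘ-fromℚᵘ (mkℚᵘ (+ a) c)) (toℚᵘ-fromℚᵘ (mkℚᵘ (+ b) d)))
              (ℚᵘ.≃-reflexive (cong (λ i → mkℚᵘ i (d ℕ.+ c ℕ.* suc d)) numerator))))
  where
  numerator : + a ℤ.* + suc d ℤ.+ + b ℤ.* + suc c ≡ + (a ℕ.* suc d ℕ.+ b ℕ.* suc c)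
  numerator = trans (cong₂ ℤ._+_ (sym (ℤ.pos-* a (suc d))) (sym (ℤ.pos-* b (suc c))))
                    (sym (ℤ.pos-+ (a ℕ.* suc d) (b ℕ.* suc c)))

toℚ-+ : ∀ m n → toℚ (m ℕ.+ n) ≡ toℚ m + toℚ n
toℚ-+ m n = sym (trans (/-+-/ m n 0 0)
  (/-cong {q₁ = 1} (cong +_ (cong₂ ℕ._+_ (ℕ.*-identityʳ m) (ℕ.*-identityʳ n))) refl))

toℚ-* : ∀ m n → toℚ (m ℕ.* n) ≡ toℚ m * toℚ n
toℚ-* m n = sym (/-*-/ m n 0 0)

toℚ-suc : ∀ n → toℚ (suc n) ≡ 1ℚ + toℚ n
toℚ-suc = toℚ-+ 1

toℚ-2* : ∀ n → toℚ (2 ℕ.* n) ≡ toℚ n + toℚ n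
toℚ-2* n = trans (cong (λ m → toℚ (n ℕ.+ m)) (ℕ.+-identityʳ n)) (toℚ-+ n n)

toℚ-1+2* : ∀ n → toℚ (suc (2 ℕ.* n)) ≡ 1ℚ + (toℚ n + toℚ n)
toℚ-1+2* n = trans (toℚ-suc (2 ℕ.* n)) (cong (λ x → 1ℚ + x) (toℚ-2* n))

toℚ-*-/ : ∀ m a c → toℚ m * (+ a / suc c) ≡ + (m ℕ.* a) / suc c
toℚ-*-/ m a c = trans (/-*-/ m a 0 c) (/-cong {p₁ = + (m ℕ.* a)} refl (ℕ.+-identityʳ (suc c)))

toℚ-*-/-cancel : ∀ a c → toℚ (suc c) * (+ a / suc c) ≡ toℚ a
toℚ-*-/-cancel a c = trans (toℚ-*-/ (suc c) a c)
  (/-cross {suc c ℕ.* a} {a} c 0 (trans (ℕ.*-identityʳ _) (ℕ.*-comm (suc c) a)))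

½ : ℚ
½ = + 1 / 2

½-*-/ : ∀ a c → ½ * (+ a / suc c) ≡ + a / (2 ℕ.* suc c)
½-*-/ a c = trans (/-*-/ 1 a 1 c) (/-cong {q₁ = 2 ℕ.* suc c} (cong +_ (ℕ.*-identityˡ a)) refl)

n/n≡1 : ∀ c → + suc c / suc c ≡ 1ℚ
n/n≡1 c = /-cross {suc c} {1} c 0 (trans (ℕ.*-identityʳ (suc c)) (sym (ℕ.*-identityˡ (suc c))))

sumℚ-cong : ∀ n {f g} → (∀ {i} → i ℕ.< n → f i ≡ g i) → sumℚ n f ≡ sumℚ n g
sumℚ-cong zero    f≡g = refl
sumℚ-cong (suc n) f≡g = cong₂ _+_ (sumℚ-cong n (f≡g ∘ ℕ.m<n⇒m<1+n)) (f≡g ℕ.≤-refl)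

sumℚ-linear : ∀ n c f g → sumℚ n (λ i → c * f i - g i) ≡ c * sumℚ n f - sumℚ n g
sumℚ-linear zero    c f g = solve 1 (λ c → con 0ℚ := c :* con 0ℚ :- con 0ℚ) refl c
sumℚ-linear (suc n) c f g = begin
  sumℚ n (λ i → c * f i - g i) + (c * f n - g n) ≡⟨ cong (_+ (c * f n - g n)) (sumℚ-linear n c f g) ⟩
  c * sumℚ n f - sumℚ n g + (c * f n - g n)       ≡⟨ regroup c (sumℚ n f) (sumℚ n g) (f n) (g n) ⟩
  c * (sumℚ n f + f n) - (sumℚ n g + g n)         ∎
  where
  open ≡-Reasoning
  regroup : ∀ c s t x y → c * s - t + (c * x - y) ≡ c * (s + x) - (t + y)
  regroup = solve 5 (λ c s t x y → c :* s :- t :+ (c :* x :- y) := c :* (s :+ x) :- (t :+ y)) refl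

toℚ-U : ∀ n → toℚ (U n) ≡ sumℚ n (λ i → toℚ (α (suc i)))
toℚ-U zero    = refl
toℚ-U (suc n) = trans (toℚ-+ (U n) (α (suc n))) (cong (_+ toℚ (α (suc n))) (toℚ-U n))

αRatio : ℕ → ℚ
αRatio i = + α (suc i) / suc i

G-summand : ∀ {n i} → i ℕ.< n →
            + ((n ℕ.∸ i) ℕ.* α (suc i)) / suc i ≡ toℚ (suc n) * αRatio i - toℚ (α (suc i))
G-summand {n} {i} i<n = begin
  + ((n ℕ.∸ i) ℕ.* α (suc i)) / suc i            ≡⟨ toℚ-*-/ (n ℕ.∸ i) (α (suc i)) i ⟨
  toℚ (n ℕ.∸ i) * αRatio i                        ≡⟨ split (toℚ (n ℕ.∸ i)) (toℚ (suc i)) (αRatio i) ⟩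
  (toℚ (n ℕ.∸ i) + toℚ (suc i)) * αRatio i - toℚ (suc i) * αRatio i
    ≡⟨ cong₂ (λ a b → a * αRatio i - b) (sym (toℚ-+ (n ℕ.∸ i) (suc i))) (toℚ-*-/-cancel (α (suc i)) i) ⟩
  toℚ (n ℕ.∸ i ℕ.+ suc i) * αRatio i - toℚ (α (suc i))
    ≡⟨ cong (λ m → toℚ m * αRatio i - toℚ (α (suc i))) n∸i+1+i≡1+n ⟩
  toℚ (suc n) * αRatio i - toℚ (α (suc i))        ∎
  where
  open ≡-Reasoning
  n∸i+1+i≡1+n : n ℕ.∸ i ℕ.+ suc i ≡ suc n
  n∸i+1+i≡1+n = trans (ℕ.+-suc (n ℕ.∸ i) i) (cong suc (ℕ.m∸n+n≡m (ℕ.<⇒≤ i<n)))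
  split : ∀ a b x → a * x ≡ (a + b) * x - b * x
  split = solve 3 (λ a b x → a :* x := (a :+ b) :* x :- b :* x) refl

G≡[n+1]V-U : ∀ n → G n ≡ toℚ (suc n) * V n - toℚ (U n)
G≡[n+1]V-U n = begin
  G n                                                       ≡⟨ sumℚ-cong n G-summand ⟩
  sumℚ n (λ i → toℚ (suc n) * αRatio i - toℚ (α (suc i)))
    ≡⟨ sumℚ-linear n (toℚ (suc n)) αRatio (toℚ ∘ α ∘ suc) ⟩
  toℚ (suc n) * V n - sumℚ n (λ i → toℚ (α (suc i)))        ≡⟨ cong (toℚ (suc n) * V n -_) (toℚ-U n) ⟨
  toℚ (suc n) * V n - toℚ (U n)                             ∎
  where open ≡-Reasoning

αRatio-2* : ∀ m → αRatio (2 ℕ.* m) ≡ 1ℚ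
αRatio-2* m = trans (cong (λ a → + a / suc (2 ℕ.* m)) (α-1+2* m)) (n/n≡1 (2 ℕ.* m))

αRatio-1+2* : ∀ m → αRatio (suc (2 ℕ.* m)) ≡ ½ * αRatio m
αRatio-1+2* m = sym (begin
  ½ * (+ α (suc m) / suc m)                ≡⟨ ½-*-/ (α (suc m)) m ⟩
  + α (suc m) / (2 ℕ.* suc m)              ≡⟨ /-cong (cong +_ (sym (α-2* (suc m)))) refl ⟩
  + α (2 ℕ.* suc m) / (2 ℕ.* suc m)        ≡⟨ /-cong (cong (λ k → + α k) (ℕ.*-suc 2 m)) (ℕ.*-suc 2 m) ⟩
  + α (2 ℕ.+ 2 ℕ.* m) / (2 ℕ.+ 2 ℕ.* m)    ∎)
  where open ≡-Reasoning

V-2* : ∀ n → V (2 ℕ.* n) ≡ ½ * V n + toℚ n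
V-2* zero    = refl
V-2* (suc m) = begin
  V (2 ℕ.* suc m)                                           ≡⟨ cong V (ℕ.*-suc 2 m) ⟩
  V (2 ℕ.* m) + αRatio (2 ℕ.* m) + αRatio (suc (2 ℕ.* m))
    ≡⟨ cong₂ _+_ (cong₂ _+_ (V-2* m) (αRatio-2* m)) (αRatio-1+2* m) ⟩
  ½ * V m + toℚ m + 1ℚ + ½ * αRatio m                      ≡⟨ regroup (V m) (toℚ m) (αRatio m) ⟩
  ½ * (V m + αRatio m) + (1ℚ + toℚ m)                      ≡⟨ cong (λ t → ½ * V (suc m) + t) (toℚ-suc m) ⟨
  ½ * V (suc m) + toℚ (suc m)                              ∎
  where
  open ≡-Reasoning
  regroup : ∀ v t x → ½ * v + t + 1ℚ + ½ * x ≡ ½ * (v + x) + (1ℚ + t)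
  regroup = solve 3 (λ v t x → con ½ :* v :+ t :+ con 1ℚ :+ con ½ :* x
                             := con ½ :* (v :+ x) :+ (con 1ℚ :+ t)) refl

V-1+2* : ∀ n → V (suc (2 ℕ.* n)) ≡ ½ * V n + toℚ n + 1ℚ
V-1+2* n = cong₂ _+_ (V-2* n) (αRatio-2* n)

U-2* : ∀ n → U (2 ℕ.* n) ≡ U n ℕ.+ n ℕ.* n
U-2* zero    = refl
U-2* (suc m) = begin
  U (2 ℕ.* suc m)                                                 ≡⟨ cong U (ℕ.*-suc 2 m) ⟩
  U (2 ℕ.* m) ℕ.+ α (suc (2 ℕ.* m)) ℕ.+ α (suc (suc (2 ℕ.* m)))
    ≡⟨ cong₂ ℕ._+_ (cong₂ ℕ._+_ (U-2* m) (α-1+2* m)) (α-2+2* m) ⟩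
  U m ℕ.+ m ℕ.* m ℕ.+ suc (2 ℕ.* m) ℕ.+ α (suc m)                ≡⟨ regroup (U m) m (α (suc m)) ⟩
  U (suc m) ℕ.+ suc m ℕ.* suc m                                   ∎
  where
  open ≡-Reasoning
  regroup : ∀ u m a → u ℕ.+ m ℕ.* m ℕ.+ suc (2 ℕ.* m) ℕ.+ a ≡ u ℕ.+ a ℕ.+ suc m ℕ.* suc m
  regroup = solve-∀

U-1+2* : ∀ n → U (suc (2 ℕ.* n)) ≡ U n ℕ.+ suc n ℕ.* suc n
U-1+2* n = begin
  U (2 ℕ.* n) ℕ.+ α (suc (2 ℕ.* n))    ≡⟨ cong₂ ℕ._+_ (U-2* n) (α-1+2* n) ⟩
  U n ℕ.+ n ℕ.* n ℕ.+ suc (2 ℕ.* n)    ≡⟨ regroup (U n) n ⟩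
  U n ℕ.+ suc n ℕ.* suc n              ∎
  where
  open ≡-Reasoning
  regroup : ∀ u m → u ℕ.+ m ℕ.* m ℕ.+ suc (2 ℕ.* m) ≡ u ℕ.+ suc m ℕ.* suc m
  regroup = solve-∀

toℚ-*suc : ∀ n → toℚ (n ℕ.* suc n) ≡ toℚ n * (1ℚ + toℚ n)
toℚ-*suc n = trans (toℚ-* n (suc n)) (cong (toℚ n *_) (toℚ-suc n))

toℚ-suc*suc : ∀ n → toℚ (suc n ℕ.* suc n) ≡ (1ℚ + toℚ n) * (1ℚ + toℚ n)
toℚ-suc*suc n = trans (toℚ-* (suc n) (suc n)) (cong₂ _*_ (toℚ-suc n) (toℚ-suc n))

toℚ-+-* : ∀ u m n → toℚ (u ℕ.+ m ℕ.* n) ≡ toℚ u + toℚ m * toℚ n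
toℚ-+-* u m n = trans (toℚ-+ u (m ℕ.* n)) (cong (λ x → toℚ u + x) (toℚ-* m n))

G≡[1+n]V-U : ∀ n → G n ≡ (1ℚ + toℚ n) * V n - toℚ (U n)
G≡[1+n]V-U n = trans (G≡[n+1]V-U n) (cong (λ a → a * V n - toℚ (U n)) (toℚ-suc n))

G-2* : ∀ n → G (2 ℕ.* n) ≡ toℚ (n ℕ.* suc n) + G n - ½ * V n
G-2* n = begin
  G (2 ℕ.* n)                                                   ≡⟨ G≡[n+1]V-U (2 ℕ.* n) ⟩
  toℚ (suc (2 ℕ.* n)) * V (2 ℕ.* n) - toℚ (U (2 ℕ.* n))
    ≡⟨ cong₂ (λ v u → toℚ (suc (2 ℕ.* n)) * v - toℚ u) (V-2* n) (U-2* n) ⟩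
  toℚ (suc (2 ℕ.* n)) * (½ * V n + N) - toℚ (U n ℕ.+ n ℕ.* n)
    ≡⟨ cong₂ (λ a u → a * (½ * V n + N) - u) (toℚ-1+2* n) (toℚ-+-* (U n) n n) ⟩
  (1ℚ + (N + N)) * (½ * V n + N) - (toℚ (U n) + N * N)          ≡⟨ regroup N (V n) (toℚ (U n)) ⟩
  N * (1ℚ + N) + ((1ℚ + N) * V n - toℚ (U n)) - ½ * V n
    ≡⟨ cong₂ (λ a g → a + g - ½ * V n) (toℚ-*suc n) (G≡[1+n]V-U n) ⟨
  toℚ (n ℕ.* suc n) + G n - ½ * V n                             ∎
  where
  open ≡-Reasoning
  N : ℚ
  N = toℚ n
  regroup : ∀ N v u → (1ℚ + (N + N)) * (½ * v + N) - (u + N * N) ≡ N * (1ℚ + N) + ((1ℚ + N) * v - u) - ½ * v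
  regroup = solve 3 (λ N v u → (con 1ℚ :+ (N :+ N)) :* (con ½ :* v :+ N) :- (u :+ N :* N)
                             := N :* (con 1ℚ :+ N) :+ ((con 1ℚ :+ N) :* v :- u) :- con ½ :* v) refl

G-1+2* : ∀ n → G (suc (2 ℕ.* n)) ≡ toℚ (suc n ℕ.* suc n) + G n
G-1+2* n = begin
  G (suc (2 ℕ.* n))                                                        ≡⟨ G≡[1+n]V-U (suc (2 ℕ.* n)) ⟩
  (1ℚ + toℚ (suc (2 ℕ.* n))) * V (suc (2 ℕ.* n)) - toℚ (U (suc (2 ℕ.* n)))
    ≡⟨ cong₂ (λ v u → (1ℚ + toℚ (suc (2 ℕ.* n))) * v - toℚ u) (V-1+2* n) (U-1+2* n) ⟩
  (1ℚ + toℚ (suc (2 ℕ.* n))) * (½ * V n + N + 1ℚ) - toℚ (U n ℕ.+ suc n ℕ.* suc n)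
    ≡⟨ cong₂ (λ a u → (1ℚ + a) * (½ * V n + N + 1ℚ) - u) (toℚ-1+2* n) toℚ-U-1+2* ⟩
  (1ℚ + (1ℚ + (N + N))) * (½ * V n + N + 1ℚ) - (toℚ (U n) + (1ℚ + N) * (1ℚ + N))
    ≡⟨ regroup N (V n) (toℚ (U n)) ⟩
  (1ℚ + N) * (1ℚ + N) + ((1ℚ + N) * V n - toℚ (U n))
    ≡⟨ cong₂ _+_ (toℚ-suc*suc n) (G≡[1+n]V-U n) ⟨
  toℚ (suc n ℕ.* suc n) + G n                                              ∎
  where
  open ≡-Reasoning
  N : ℚ
  N = toℚ n
  toℚ-U-1+2* : toℚ (U n ℕ.+ suc n ℕ.* suc n) ≡ toℚ (U n) + (1ℚ + N) * (1ℚ + N)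
  toℚ-U-1+2* = trans (toℚ-+-* (U n) (suc n) (suc n)) (cong (λ k → toℚ (U n) + k * k) (toℚ-suc n))
  regroup : ∀ N v u → (1ℚ + (1ℚ + (N + N))) * (½ * v + N + 1ℚ) - (u + (1ℚ + N) * (1ℚ + N))
                    ≡ (1ℚ + N) * (1ℚ + N) + ((1ℚ + N) * v - u)
  regroup = solve 3 (λ N v u → (con 1ℚ :+ (con 1ℚ :+ (N :+ N))) :* (con ½ :* v :+ N :+ con 1ℚ)
                                :- (u :+ (con 1ℚ :+ N) :* (con 1ℚ :+ N))
                             := (con 1ℚ :+ N) :* (con 1ℚ :+ N) :+ ((con 1ℚ :+ N) :* v :- u)) refl

⅓ ⅔ ¼ ⅙ ⅚ ¹⁄₁₂ : ℚ
⅓ = + 1 / 3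
⅔ = + 2 / 3
¼ = + 1 / 4
⅙ = + 1 / 6
⅚ = + 5 / 6
¹⁄₁₂ = + 1 / 12

≤-by-gap : ∀ {x y} d → 0ℚ ≤ d → x + d ≡ y → x ≤ y
≤-by-gap {x} d 0≤d refl = subst (_≤ x + d) (+-identityʳ x) (+-monoʳ-≤ x 0≤d)

0≤toℚ*c+d : ∀ m {c d} → .{{NonNegative c}} → .{{NonNegative d}} → 0ℚ ≤ toℚ m * c + d
0≤toℚ*c+d m {c} {d} = nonNegative⁻¹ _
  {{nonNeg+nonNeg⇒nonNeg (toℚ m * c) {{nonNeg*nonNeg⇒nonNeg (toℚ m) {{normalize-nonNeg m 1}} c}} d}}

toℚ-1+2*suc : ∀ m → toℚ (suc (2 ℕ.* suc m)) ≡ 1ℚ + ((1ℚ + toℚ m) + (1ℚ + toℚ m))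
toℚ-1+2*suc m = trans (toℚ-1+2* (suc m)) (cong (λ k → 1ℚ + (k + k)) (toℚ-suc m))

toℚ-2*suc : ∀ m → toℚ (2 ℕ.* suc m) ≡ (1ℚ + toℚ m) + (1ℚ + toℚ m)
toℚ-2*suc m = trans (toℚ-2* (suc m)) (cong (λ k → k + k) (toℚ-suc m))

V-lower : ∀ n → toℚ n * ⅔ ≤ V n
V-lower = binary-induction (≤ᵇ⇒≤ _) odd-step even-step
  where
  open ≤-Reasoning
  odd-step : ∀ n → toℚ n * ⅔ ≤ V n → toℚ (suc (2 ℕ.* n)) * ⅔ ≤ V (suc (2 ℕ.* n))
  odd-step n ih = let N = toℚ n in begin
    toℚ (suc (2 ℕ.* n)) * ⅔  ≡⟨ cong (_* ⅔) (toℚ-1+2* n) ⟩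
    (1ℚ + (N + N)) * ⅔       ≤⟨ ≤-by-gap ⅓ (≤ᵇ⇒≤ _) (identity N) ⟩
    ½ * (N * ⅔) + N + 1ℚ     ≤⟨ +-monoˡ-≤ 1ℚ (+-monoˡ-≤ N (*-monoˡ-≤-nonNeg ½ ih)) ⟩
    ½ * V n + N + 1ℚ         ≡⟨ V-1+2* n ⟨
    V (suc (2 ℕ.* n))        ∎
    where
    identity : ∀ N → (1ℚ + (N + N)) * ⅔ + ⅓ ≡ ½ * (N * ⅔) + N + 1ℚ
    identity = solve 1 (λ N → (con 1ℚ :+ (N :+ N)) :* con ⅔ :+ con ⅓
                            := con ½ :* (N :* con ⅔) :+ N :+ con 1ℚ) refl
  even-step : ∀ n → toℚ (suc n) * ⅔ ≤ V (suc n) → toℚ (2 ℕ.* suc n) * ⅔ ≤ V (2 ℕ.* suc n)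
  even-step n ih = let K = toℚ (suc n) in begin
    toℚ (2 ℕ.* suc n) * ⅔  ≡⟨ cong (_* ⅔) (toℚ-2* (suc n)) ⟩
    (K + K) * ⅔            ≡⟨ identity K ⟩
    ½ * (K * ⅔) + K        ≤⟨ +-monoˡ-≤ K (*-monoˡ-≤-nonNeg ½ ih) ⟩
    ½ * V (suc n) + K      ≡⟨ V-2* (suc n) ⟨
    V (2 ℕ.* suc n)        ∎
    where
    identity : ∀ K → (K + K) * ⅔ ≡ ½ * (K * ⅔) + K
    identity = solve 1 (λ K → (K :+ K) :* con ⅔ := con ½ :* (K :* con ⅔) :+ K) refl

V-2*-upper : ∀ n {b} → V n ≤ b → V (2 ℕ.* n) ≤ ½ * b + toℚ n
V-2*-upper n {b} V≤b =
  subst (_≤ ½ * b + toℚ n) (sym (V-2* n)) (+-monoˡ-≤ (toℚ n) (*-monoˡ-≤-nonNeg ½ V≤b))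

V-1+2*-upper : ∀ n {b} → V n ≤ b → V (suc (2 ℕ.* n)) ≤ ½ * b + toℚ n + 1ℚ
V-1+2*-upper n {b} V≤b =
  subst (_≤ ½ * b + toℚ n + 1ℚ) (sym (V-1+2* n)) (+-monoˡ-≤ 1ℚ (+-monoˡ-≤ (toℚ n) (*-monoˡ-≤-nonNeg ½ V≤b)))

-- The slack ⅙ is forced by V 1 = 1; V-upper-sharp recovers 5n/6 for n ≥ 2 (with
-- equality at n = 3), which is what the lower bound on G needs.
V-upper : ∀ n → V n ≤ toℚ n * ⅚ + ⅙
V-upper = binary-induction (≤ᵇ⇒≤ _) odd-step even-step
  where
  open ≤-Reasoning
  odd-step : ∀ n → V n ≤ toℚ n * ⅚ + ⅙ → V (suc (2 ℕ.* n)) ≤ toℚ (suc (2 ℕ.* n)) * ⅚ + ⅙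
  odd-step zero    _  = ≤ᵇ⇒≤ _
  odd-step (suc m) ih = let K = toℚ (suc m); M = toℚ m in begin
    V (suc (2 ℕ.* suc m))                         ≤⟨ V-1+2*-upper (suc m) ih ⟩
    ½ * (K * ⅚ + ⅙) + K + 1ℚ                      ≡⟨ cong (λ k → ½ * (k * ⅚ + ⅙) + k + 1ℚ) (toℚ-suc m) ⟩
    ½ * ((1ℚ + M) * ⅚ + ⅙) + (1ℚ + M) + 1ℚ        ≤⟨ ≤-by-gap (M * ¼ + ⅙) (0≤toℚ*c+d m) (identity M) ⟩
    (1ℚ + ((1ℚ + M) + (1ℚ + M))) * ⅚ + ⅙          ≡⟨ cong (λ x → x * ⅚ + ⅙) (toℚ-1+2*suc m) ⟨
    toℚ (suc (2 ℕ.* suc m)) * ⅚ + ⅙               ∎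
    where
    identity : ∀ M → ½ * ((1ℚ + M) * ⅚ + ⅙) + (1ℚ + M) + 1ℚ + (M * ¼ + ⅙)
                   ≡ (1ℚ + ((1ℚ + M) + (1ℚ + M))) * ⅚ + ⅙
    identity = solve 1 (λ M → con ½ :* ((con 1ℚ :+ M) :* con ⅚ :+ con ⅙) :+ (con 1ℚ :+ M) :+ con 1ℚ
                              :+ (M :* con ¼ :+ con ⅙)
                            := (con 1ℚ :+ ((con 1ℚ :+ M) :+ (con 1ℚ :+ M))) :* con ⅚ :+ con ⅙) refl
  even-step : ∀ n → V (suc n) ≤ toℚ (suc n) * ⅚ + ⅙ → V (2 ℕ.* suc n) ≤ toℚ (2 ℕ.* suc n) * ⅚ + ⅙
  even-step n ih = let K = toℚ (suc n) in begin
    V (2 ℕ.* suc n)              ≤⟨ V-2*-upper (suc n) ih ⟩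
    ½ * (K * ⅚ + ⅙) + K          ≤⟨ ≤-by-gap (K * ¼ + ¹⁄₁₂) (0≤toℚ*c+d (suc n)) (identity K) ⟩
    (K + K) * ⅚ + ⅙              ≡⟨ cong (λ x → x * ⅚ + ⅙) (toℚ-2* (suc n)) ⟨
    toℚ (2 ℕ.* suc n) * ⅚ + ⅙    ∎
    where
    identity : ∀ K → ½ * (K * ⅚ + ⅙) + K + (K * ¼ + ¹⁄₁₂) ≡ (K + K) * ⅚ + ⅙
    identity = solve 1 (λ K → con ½ :* (K :* con ⅚ :+ con ⅙) :+ K :+ (K :* con ¼ :+ con ¹⁄₁₂)
                            := (K :+ K) :* con ⅚ :+ con ⅙) refl

V-upper-sharp : ∀ n → 2 ℕ.≤ n → V n ≤ toℚ n * ⅚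
V-upper-sharp n 2≤n with halving n
V-upper-sharp _ ()       | even zero
V-upper-sharp _ (s≤s ()) | odd zero
... | even (suc m) = let K = toℚ (suc m); M = toℚ m in begin
  V (2 ℕ.* suc m)                      ≤⟨ V-2*-upper (suc m) (V-upper (suc m)) ⟩
  ½ * (K * ⅚ + ⅙) + K                  ≡⟨ cong (λ k → ½ * (k * ⅚ + ⅙) + k) (toℚ-suc m) ⟩
  ½ * ((1ℚ + M) * ⅚ + ⅙) + (1ℚ + M)    ≤⟨ ≤-by-gap (M * ¼ + ⅙) (0≤toℚ*c+d m) (identity M) ⟩
  ((1ℚ + M) + (1ℚ + M)) * ⅚            ≡⟨ cong (_* ⅚) (toℚ-2*suc m) ⟨
  toℚ (2 ℕ.* suc m) * ⅚                ∎
  where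
  open ≤-Reasoning
  identity : ∀ M → ½ * ((1ℚ + M) * ⅚ + ⅙) + (1ℚ + M) + (M * ¼ + ⅙) ≡ ((1ℚ + M) + (1ℚ + M)) * ⅚
  identity = solve 1 (λ M → con ½ :* ((con 1ℚ :+ M) :* con ⅚ :+ con ⅙) :+ (con 1ℚ :+ M)
                            :+ (M :* con ¼ :+ con ⅙)
                          := ((con 1ℚ :+ M) :+ (con 1ℚ :+ M)) :* con ⅚) refl
... | odd (suc m) = let K = toℚ (suc m); M = toℚ m in begin
  V (suc (2 ℕ.* suc m))                     ≤⟨ V-1+2*-upper (suc m) (V-upper (suc m)) ⟩
  ½ * (K * ⅚ + ⅙) + K + 1ℚ                  ≡⟨ cong (λ k → ½ * (k * ⅚ + ⅙) + k + 1ℚ) (toℚ-suc m) ⟩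
  ½ * ((1ℚ + M) * ⅚ + ⅙) + (1ℚ + M) + 1ℚ    ≤⟨ ≤-by-gap (M * ¼ + 0ℚ) (0≤toℚ*c+d m) (identity M) ⟩
  (1ℚ + ((1ℚ + M) + (1ℚ + M))) * ⅚          ≡⟨ cong (_* ⅚) (toℚ-1+2*suc m) ⟨
  toℚ (suc (2 ℕ.* suc m)) * ⅚               ∎
  where
  open ≤-Reasoning
  identity : ∀ M → ½ * ((1ℚ + M) * ⅚ + ⅙) + (1ℚ + M) + 1ℚ + (M * ¼ + 0ℚ)
                 ≡ (1ℚ + ((1ℚ + M) + (1ℚ + M))) * ⅚
  identity = solve 1 (λ M → con ½ :* ((con 1ℚ :+ M) :* con ⅚ :+ con ⅙) :+ (con 1ℚ :+ M) :+ con 1ℚ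
                            :+ (M :* con ¼ :+ con 0ℚ)
                          := (con 1ℚ :+ ((con 1ℚ :+ M) :+ (con 1ℚ :+ M))) :* con ⅚) refl

G-upper : ∀ n → G n ≤ toℚ n * (toℚ n + toℚ 2) * ⅓
G-upper = binary-induction (≤ᵇ⇒≤ _) odd-step even-step
  where
  open ≤-Reasoning
  bound : ℚ → ℚ
  bound x = x * (x + toℚ 2) * ⅓
  odd-step : ∀ n → G n ≤ bound (toℚ n) → G (suc (2 ℕ.* n)) ≤ bound (toℚ (suc (2 ℕ.* n)))
  odd-step n ih = let N = toℚ n in begin
    G (suc (2 ℕ.* n))                ≡⟨ G-1+2* n ⟩
    toℚ (suc n ℕ.* suc n) + G n      ≤⟨ +-monoʳ-≤ (toℚ (suc n ℕ.* suc n)) ih ⟩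
    toℚ (suc n ℕ.* suc n) + bound N  ≡⟨ cong (_+ bound N) (toℚ-suc*suc n) ⟩
    (1ℚ + N) * (1ℚ + N) + bound N    ≡⟨ identity N ⟩
    bound (1ℚ + (N + N))             ≡⟨ cong bound (toℚ-1+2* n) ⟨
    bound (toℚ (suc (2 ℕ.* n)))      ∎
    where
    identity : ∀ N → (1ℚ + N) * (1ℚ + N) + bound N ≡ bound (1ℚ + (N + N))
    identity = solve 1 (λ N → (con 1ℚ :+ N) :* (con 1ℚ :+ N) :+ N :* (N :+ con (toℚ 2)) :* con ⅓
                            := (con 1ℚ :+ (N :+ N)) :* ((con 1ℚ :+ (N :+ N)) :+ con (toℚ 2)) :* con ⅓) refl
  even-step : ∀ n → G (suc n) ≤ bound (toℚ (suc n)) → G (2 ℕ.* suc n) ≤ bound (toℚ (2 ℕ.* suc n))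
  even-step n ih = let k = suc n; K = toℚ (suc n) in begin
    G (2 ℕ.* k)                                  ≡⟨ G-2* k ⟩
    toℚ (k ℕ.* suc k) + G k - ½ * V k
      ≤⟨ +-mono-≤ (+-monoʳ-≤ (toℚ (k ℕ.* suc k)) ih) (neg-antimono-≤ (*-monoˡ-≤-nonNeg ½ (V-lower k))) ⟩
    toℚ (k ℕ.* suc k) + bound K - ½ * (K * ⅔)    ≡⟨ cong (λ x → x + bound K - ½ * (K * ⅔)) (toℚ-*suc k) ⟩
    K * (1ℚ + K) + bound K - ½ * (K * ⅔)         ≡⟨ identity K ⟩
    bound (K + K)                                ≡⟨ cong bound (toℚ-2* k) ⟨
    bound (toℚ (2 ℕ.* k))                        ∎
    where
    identity : ∀ K → K * (1ℚ + K) + bound K - ½ * (K * ⅔) ≡ bound (K + K)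
    identity = solve 1 (λ K → K :* (con 1ℚ :+ K) :+ K :* (K :+ con (toℚ 2)) :* con ⅓ :- con ½ :* (K :* con ⅔)
                            := (K :+ K) :* ((K :+ K) :+ con (toℚ 2)) :* con ⅓) refl

G-lower : ∀ n → toℚ n * (toℚ n + + 7 / 4) * ⅓ ≤ G n
G-lower = binary-induction (≤ᵇ⇒≤ _) odd-step even-step
  where
  open ≤-Reasoning
  bound : ℚ → ℚ
  bound x = x * (x + + 7 / 4) * ⅓
  odd-step : ∀ n → bound (toℚ n) ≤ G n → bound (toℚ (suc (2 ℕ.* n))) ≤ G (suc (2 ℕ.* n))
  odd-step n ih = let N = toℚ n in begin
    bound (toℚ (suc (2 ℕ.* n)))      ≡⟨ cong bound (toℚ-1+2* n) ⟩
    bound (1ℚ + (N + N))             ≤⟨ ≤-by-gap (N * ¹⁄₁₂ + ¹⁄₁₂) (0≤toℚ*c+d n) (identity N) ⟩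
    (1ℚ + N) * (1ℚ + N) + bound N    ≡⟨ cong (_+ bound N) (toℚ-suc*suc n) ⟨
    toℚ (suc n ℕ.* suc n) + bound N  ≤⟨ +-monoʳ-≤ (toℚ (suc n ℕ.* suc n)) ih ⟩
    toℚ (suc n ℕ.* suc n) + G n      ≡⟨ G-1+2* n ⟨
    G (suc (2 ℕ.* n))                ∎
    where
    identity : ∀ N → bound (1ℚ + (N + N)) + (N * ¹⁄₁₂ + ¹⁄₁₂) ≡ (1ℚ + N) * (1ℚ + N) + bound N
    identity = solve 1 (λ N → (con 1ℚ :+ (N :+ N)) :* ((con 1ℚ :+ (N :+ N)) :+ con (+ 7 / 4)) :* con ⅓
                              :+ (N :* con ¹⁄₁₂ :+ con ¹⁄₁₂)
                            := (con 1ℚ :+ N) :* (con 1ℚ :+ N) :+ N :* (N :+ con (+ 7 / 4)) :* con ⅓) refl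
  even-step : ∀ n → bound (toℚ (suc n)) ≤ G (suc n) → bound (toℚ (2 ℕ.* suc n)) ≤ G (2 ℕ.* suc n)
  -- Equality holds at n = 2, which the step from n = 1 cannot reach.
  even-step zero    _  = ≤ᵇ⇒≤ _
  even-step (suc m) ih = let k = suc (suc m); K = toℚ k in begin
    bound (toℚ (2 ℕ.* k))                        ≡⟨ cong bound (toℚ-2* k) ⟩
    bound (K + K)                                ≡⟨ identity K ⟩
    K * (1ℚ + K) + bound K - ½ * (K * ⅚)
      ≤⟨ +-mono-≤ (+-monoʳ-≤ (K * (1ℚ + K)) ih)
                  (neg-antimono-≤ (*-monoˡ-≤-nonNeg ½ (V-upper-sharp k (s≤s (s≤s z≤n))))) ⟩
    K * (1ℚ + K) + G k - ½ * V k                 ≡⟨ cong (λ x → x + G k - ½ * V k) (toℚ-*suc k) ⟨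
    toℚ (k ℕ.* suc k) + G k - ½ * V k            ≡⟨ G-2* k ⟨
    G (2 ℕ.* k)                                  ∎
    where
    identity : ∀ K → bound (K + K) ≡ K * (1ℚ + K) + bound K - ½ * (K * ⅚)
    identity = solve 1 (λ K → (K :+ K) :* ((K :+ K) :+ con (+ 7 / 4)) :* con ⅓
                            := K :* (con 1ℚ :+ K) :+ K :* (K :+ con (+ 7 / 4)) :* con ⅓ :- con ½ :* (K :* con ⅚)) refl

proposition4 : (n : ℕ) → .{{_ : NonZero n}} →
    (G n ≡ toℚ (suc n) * V n - toℚ (U n))
    × (G (2 Data.Nat.* n) ≡ toℚ (n Data.Nat.* suc n) + G n - ((+ 1) / 2) * V n)
    × (G (suc (2 Data.Nat.* n)) ≡ toℚ (suc n Data.Nat.* suc n) + G n)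
    × (toℚ n * (toℚ n + (+ 7) / 4) * ((+ 1) / 3) ≤ G n)
    × (G n ≤ toℚ n * (toℚ n + toℚ 2) * ((+ 1) / 3))
proposition4 n = G≡[n+1]V-U n , G-2* n , G-1+2* n , G-lower n , G-upper n
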